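{- Let $p$ be an odd prime, let $q\in\mathbb{C}_p$ with $|1-q|_p<p^{ -1/(p-1)}$, let $\lambda\in\mathbb{Z}_p$ with $\lambda\neq 0$, and let $x\in\mathbb{Z}_p$. Then for every integer $m\geq 0$, \[ \sum_{n=0}^{m}Bl_{n,q}(x|\lambda)S_2(m,n)=\frac{1}{[2]_q}E_{m,q}\!\left(\frac{x}{\lambda}\right)\lambda^{m}. \]
   Context: Write $[2]_q=1+q$. $(1+t)^x$ denotes $\sum_{n\ge0}\binom{x}{n}t^n$. The $q$-Boole polynomials $Bl_{n,q}(x|\lambda)$ are defined by $\frac{1}{1+q(1+t)^{\lambda}}(1+t)^x=\sum_{n\ge0}Bl_{n,q}(x|\lambda)\frac{t^n}{n!}$. The $q$-Euler polynomials $E_{n,q}(x)$ are defined by $\frac{[2]_q}{qe^t+1}e^{xt}=\sum_{n\ge0}E_{n,q}(x)\frac{t^n}{n!}$ (polynomials in $x$). The Stirling numbers of the second kind are defined by $(e^t-1)^m=m!\sum_{l\ge m}S_2(l,m)\frac{t^l}{l!}$. -}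

module Defs where

open import Level using (Level; suc; _⊔_)
open import Algebra.Bundles using (CommutativeRing)
open import Data.Nat as ℕ using (ℕ; zero)
open import Data.Nat.Base using () renaming (_! to _ℕ!)
open import Data.List using (List; []; _∷_)
open import Relation.Nullary using (¬_)

-- A field of characteristic zero, given as a commutative ring together with
-- a (total) inverse function that is a genuine inverse on nonzero elements.
-- (C_p, the field of the paper, is an instance.)
-- the canonical image of a natural number in a ring: 0 ↦ 0, n+1 ↦ 1 + n
ofℕ : ∀ {c ℓ} (R : CommutativeRing c ℓ) → ℕ → CommutativeRing.Carrier R
ofℕ R zero      = CommutativeRing.0# R
ofℕ R (ℕ.suc n) = CommutativeRing._+_ R (CommutativeRing.1# R) (ofℕ R n)

record Char0Field (c ℓ : Level) : Set (suc (c ⊔ ℓ)) where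
  field
    cring : CommutativeRing c ℓ
  open CommutativeRing cring public
  field
    inv       : Carrier → Carrier
    inv-cong  : ∀ {x y} → x ≈ y → inv x ≈ inv y
    inverseʳ  : ∀ x → ¬ (x ≈ 0#) → x * inv x ≈ 1#
    nontrivial : ¬ (1# ≈ 0#)
    char0     : ∀ n → ¬ (ofℕ cring (ℕ.suc n) ≈ 0#)

module Series {c ℓ} (F : Char0Field c ℓ) where
  open Char0Field F public

  _^_ : Carrier → ℕ → Carrier
  x ^ zero    = 1#
  x ^ ℕ.suc n = x * (x ^ n)

  sumTo : ℕ → (ℕ → Carrier) → Carrier
  sumTo zero      f = f 0
  sumTo (ℕ.suc n) f = sumTo n f + f (ℕ.suc n)

  -- formal power series in t, as coefficient sequences
  PS : Set c
  PS = ℕ → Carrier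

  oneS : PS
  oneS zero      = 1#
  oneS (ℕ.suc _) = 0#

  _⊕_ : PS → PS → PS
  (a ⊕ b) n = a n + b n

  scale : Carrier → PS → PS
  scale c a n = c * a n

  _⊗_ : PS → PS → PS
  (a ⊗ b) n = sumTo n (λ k → a k * b (n ℕ.∸ k))

  powS : PS → ℕ → PS
  powS a zero      = oneS
  powS a (ℕ.suc m) = a ⊗ powS a m

  -- multiplicative inverse of a power series (meaningful when a 0 ≠ 0):
  -- b 0 = a0⁻¹,  b (n+1) = - a0⁻¹ Σ_{k=1}^{n+1} a k · b (n+1-k)
  private
    nth : List Carrier → ℕ → Carrier
    nth []       _         = 0#
    nth (x ∷ _)  zero      = x
    nth (_ ∷ xs) (ℕ.suc i) = nth xs i

    -- invs a n = [b n , b (n-1) , … , b 0]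
    invs : PS → ℕ → List Carrier
    invs a zero      = inv (a 0) ∷ []
    invs a (ℕ.suc n) =
      (- (inv (a 0) * sumTo n (λ i → a (ℕ.suc i) * nth (invs a n) i)))
        ∷ invs a n

  invS : PS → PS
  invS a n = nth (invs a n) 0

  fact : ℕ → Carrier
  fact n = ofℕ cring (n ℕ!)

  expS : Carrier → PS
  expS c n = (c ^ n) * inv (fact n)

  fallingFact : Carrier → ℕ → Carrier
  fallingFact x zero      = 1#
  fallingFact x (ℕ.suc n) = fallingFact x n * (x - ofℕ cring n)

  binom : Carrier → ℕ → Carrier
  binom x n = fallingFact x n * inv (fact n)

  -- (1+t)^x = Σ binom(x,n) t^n
  binomS : Carrier → PS
  binomS x = binom x

  [2]_ : Carrier → Carrier
  [2] q = 1# + q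

  -- q-Boole polynomials:  1/(1+q(1+t)^λ) (1+t)^x = Σ Bl_{n,q}(x|λ) t^n/n!
  Bl : ℕ → Carrier → Carrier → Carrier → Carrier
  Bl n q x lam = fact n * ((invS (oneS ⊕ scale q (binomS lam)) ⊗ binomS x) n)

  -- q-Euler polynomials:  [2]_q/(q e^t + 1) e^{xt} = Σ E_{n,q}(x) t^n/n!
  E : ℕ → Carrier → Carrier → Carrier
  E n q x = fact n * (scale ([2] q) (invS (scale q (expS 1#) ⊕ oneS) ⊗ expS x) n)

  -- Stirling numbers of the second kind, via (e^t-1)^m = m! Σ_l S₂(l,m) t^l/l!
  expMinus1 : PS
  expMinus1 n = expS 1# n + - oneS n

  S₂ : ℕ → ℕ → Carrier
  S₂ l m = fact l * inv (fact m) * powS expMinus1 m l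

module Submission where

-- Write g = e^t - 1 and G n = gⁿ.  Substituting t ↦ g, i.e.
-- comp a = Σ_n a_n gⁿ, is a homomorphism of power-series rings, and
-- comp ((1+t)^x) = e^{xt} because both sides solve f' = x f, f(0) = 1.
-- Since S₂(m,n) = (m!/n!) [t^m] gⁿ, the left-hand side is m! times the
-- m-th coefficient of comp B, where B = (1+t)^x / (1+q(1+t)^λ) is the
-- generating function of Bl/n!; hence it is the m-th coefficient of
-- e^{xt} / (1 + q e^{λt}).  The rescaling t ↦ λt is also a ring
-- homomorphism, and it maps [2]_q⁻¹ Σ E_{m,q}(x/λ) t^m/m! to the same
-- series.

open import Defs
open import Level using (Level)
open import Data.Nat using (ℕ)
open import Relation.Nullary using (¬_)

open import Level using (_⊔_)
open import Data.Nat as ℕ using (zero; suc; _≤_; _<_; z≤n; s≤s; _∸_)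
import Data.Nat.Properties as ℕₚ
open import Data.Product using (Σ; proj₁; _,_)
open import Data.Sum using (inj₁; inj₂)
open import Relation.Binary.PropositionalEquality as ≡ using (_≡_)

module Proof {c ℓ} (F : Char0Field c ℓ) where
  open Series F
  open import Relation.Binary.Reasoning.Setoid setoid
  open import Algebra.Properties.Ring ring using (-‿distribʳ-*; -0#≈0#)
  open import Algebra.Properties.Group +-group using (∙-cancelʳ)
  open import Algebra.Properties.CommutativeSemigroup +-commutativeSemigroup
    using (interchange)
  open import Algebra.Properties.CommutativeSemigroup *-commutativeSemigroup
    using (x∙yz≈y∙xz)
  open import Algebra.Solver.Ring.NaturalCoefficients.Default commutativeSemiring
    using (solve; _:=_; _:+_; _:*_; con)

  ≡⇒≈ : ∀ {a b} → a ≡ b → a ≈ b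
  ≡⇒≈ ≡.refl = refl

  ι : ℕ → Carrier
  ι = ofℕ cring

  sum-cong : ∀ n {f g : ℕ → Carrier} → (∀ k → k ≤ n → f k ≈ g k) →
             sumTo n f ≈ sumTo n g
  sum-cong zero    f≈g = f≈g 0 z≤n
  sum-cong (suc n) f≈g =
    +-cong (sum-cong n (λ k k≤n → f≈g k (ℕₚ.m≤n⇒m≤1+n k≤n))) (f≈g (suc n) ℕₚ.≤-refl)

  sum-+ : ∀ n (f g : ℕ → Carrier) →
          sumTo n (λ k → f k + g k) ≈ sumTo n f + sumTo n g
  sum-+ zero    f g = refl
  sum-+ (suc n) f g = trans (+-cong (sum-+ n f g) refl) (interchange _ _ _ _)

  sum-*ˡ : ∀ n a (f : ℕ → Carrier) → a * sumTo n f ≈ sumTo n (λ k → a * f k)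
  sum-*ˡ zero    a f = refl
  sum-*ˡ (suc n) a f = trans (distribˡ a _ _) (+-cong (sum-*ˡ n a f) refl)

  sum-*ʳ : ∀ n a (f : ℕ → Carrier) → sumTo n f * a ≈ sumTo n (λ k → f k * a)
  sum-*ʳ zero    a f = refl
  sum-*ʳ (suc n) a f = trans (distribʳ a _ _) (+-cong (sum-*ʳ n a f) refl)

  sum-zero : ∀ n (f : ℕ → Carrier) → (∀ k → k ≤ n → f k ≈ 0#) → sumTo n f ≈ 0#
  sum-zero n f f≈0 = trans (sum-cong n f≈0) (vanish n)
    where
    vanish : ∀ n → sumTo n (λ _ → 0#) ≈ 0#
    vanish zero    = refl
    vanish (suc n) = trans (+-identityʳ _) (vanish n)

  sum-shift : ∀ n (f : ℕ → Carrier) → sumTo (suc n) f ≈ f 0 + sumTo n (λ k → f (suc k))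
  sum-shift zero    f = refl
  sum-shift (suc n) f = trans (+-cong (sum-shift n f) refl) (+-assoc _ _ _)

  sum-extend : ∀ n N (f : ℕ → Carrier) → n ≤ N →
               (∀ k → n < k → k ≤ N → f k ≈ 0#) → sumTo N f ≈ sumTo n f
  sum-extend n zero    f z≤n _ = refl
  sum-extend n (suc N) f n≤N f≈0 with ℕₚ.m≤n⇒m<n∨m≡n n≤N
  ... | inj₂ ≡.refl     = refl
  ... | inj₁ (s≤s n≤N′) =
    trans (+-cong (sum-extend n N f n≤N′ (λ k n<k k≤N → f≈0 k n<k (ℕₚ.m≤n⇒m≤1+n k≤N)))
                  (f≈0 (suc N) (s≤s n≤N′) ℕₚ.≤-refl))
          (+-identityʳ _)

  sum-swap : ∀ N M (f : ℕ → ℕ → Carrier) →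
             sumTo N (λ i → sumTo M (f i)) ≈ sumTo M (λ j → sumTo N (λ i → f i j))
  sum-swap zero    M f = refl
  sum-swap (suc N) M f = trans (+-cong (sum-swap N M f) refl) (sym (sum-+ M _ _))

  private
    suc∸ : ∀ {k n} → k ≤ n → suc n ∸ k ≡ suc (n ∸ k)
    suc∸ = ℕₚ.+-∸-assoc 1

  -- Σ_{n≤m} Σ_{i≤n} h i (n-i) = Σ_{i≤m} Σ_{j≤m-i} h i j : both run over i + j ≤ m
  triangle : ∀ m (h : ℕ → ℕ → Carrier) →
    sumTo m (λ n → sumTo n (λ i → h i (n ∸ i))) ≈ sumTo m (λ i → sumTo (m ∸ i) (h i))
  triangle zero    h = refl
  triangle (suc m) h = begin
      sumTo m (λ n → sumTo n (λ i → h i (n ∸ i))) + sumTo (suc m) (λ i → h i (suc m ∸ i))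
    ≈⟨ +-cong (triangle m h) refl ⟩
      sumTo m (λ i → sumTo (m ∸ i) (h i)) + (sumTo m (λ i → h i (suc m ∸ i)) + h (suc m) (suc m ∸ suc m))
    ≈⟨ sym (+-assoc _ _ _) ⟩
      (sumTo m (λ i → sumTo (m ∸ i) (h i)) + sumTo m (λ i → h i (suc m ∸ i))) + h (suc m) (m ∸ m)
    ≈⟨ +-cong (sym (sum-+ m _ _)) (≡⇒≈ (≡.cong (h (suc m)) (ℕₚ.n∸n≡0 m))) ⟩
      sumTo m (λ i → sumTo (m ∸ i) (h i) + h i (suc m ∸ i)) + h (suc m) 0
    ≈⟨ +-cong (sum-cong m (λ i i≤m → ≡⇒≈ (≡.cong (λ j → sumTo (m ∸ i) (h i) + h i j) (suc∸ i≤m))))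
              (≡⇒≈ (≡.cong (λ j → sumTo j (h (suc m))) (≡.sym (ℕₚ.n∸n≡0 m)))) ⟩
      sumTo m (λ i → sumTo (suc (m ∸ i)) (h i)) + sumTo (m ∸ m) (h (suc m))
    ≈⟨ +-cong (sum-cong m (λ i i≤m → ≡⇒≈ (≡.cong (λ j → sumTo j (h i)) (≡.sym (suc∸ i≤m))))) refl ⟩
      sumTo m (λ i → sumTo (suc m ∸ i) (h i)) + sumTo (suc m ∸ suc m) (h (suc m))
    ∎

  infix 4 _≋_
  _≋_ : PS → PS → Set ℓ
  a ≋ b = ∀ n → a n ≈ b n

  ≋-refl : ∀ {a} → a ≋ a
  ≋-refl n = refl

  ≋-sym : ∀ {a b} → a ≋ b → b ≋ a
  ≋-sym a≋b n = sym (a≋b n)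

  ≋-trans : ∀ {a b d} → a ≋ b → b ≋ d → a ≋ d
  ≋-trans a≋b b≋d n = trans (a≋b n) (b≋d n)

  ⊗-cong : ∀ {a a′ b b′} → a ≋ a′ → b ≋ b′ → (a ⊗ b) ≋ (a′ ⊗ b′)
  ⊗-cong a≋ b≋ n = sum-cong n (λ k _ → *-cong (a≋ k) (b≋ (n ∸ k)))

  ⊕-cong : ∀ {a a′ b b′} → a ≋ a′ → b ≋ b′ → (a ⊕ b) ≋ (a′ ⊕ b′)
  ⊕-cong a≋ b≋ n = +-cong (a≋ n) (b≋ n)

  ⊕-comm : ∀ a b → (a ⊕ b) ≋ (b ⊕ a)
  ⊕-comm a b n = +-comm (a n) (b n)

  scale-cong : ∀ {s s′ a a′} → s ≈ s′ → a ≋ a′ → scale s a ≋ scale s′ a′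
  scale-cong s≈ a≋ n = *-cong s≈ (a≋ n)

  ⊗-distribˡ : ∀ a b d → (a ⊗ (b ⊕ d)) ≋ ((a ⊗ b) ⊕ (a ⊗ d))
  ⊗-distribˡ a b d n = trans (sum-cong n (λ k _ → distribˡ _ _ _)) (sum-+ n _ _)

  ⊗-distribʳ : ∀ a b d → ((a ⊕ b) ⊗ d) ≋ ((a ⊗ d) ⊕ (b ⊗ d))
  ⊗-distribʳ a b d n = trans (sum-cong n (λ k _ → distribʳ _ _ _)) (sum-+ n _ _)

  ⊗-scaleʳ : ∀ a s b → (a ⊗ scale s b) ≋ scale s (a ⊗ b)
  ⊗-scaleʳ a s b n = trans (sum-cong n (λ k _ → x∙yz≈y∙xz _ _ _)) (sym (sum-*ˡ n s _))

  ⊗-identityˡ : ∀ a → (oneS ⊗ a) ≋ a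
  ⊗-identityˡ a zero    = *-identityˡ _
  ⊗-identityˡ a (suc n) =
    trans (sum-shift n _)
          (trans (+-cong (*-identityˡ _) (sum-zero n _ (λ k _ → zeroˡ _))) (+-identityʳ _))

  ⊗-assoc : ∀ a b d → ((a ⊗ b) ⊗ d) ≋ (a ⊗ (b ⊗ d))
  ⊗-assoc a b d n = begin
      sumTo n (λ k → sumTo k (λ i → a i * b (k ∸ i)) * d (n ∸ k))
    ≈⟨ sum-cong n (λ k k≤n → trans (sum-*ʳ k _ _) (sum-cong k (λ i i≤k →
          *-cong refl (≡⇒≈ (≡.cong (λ j → d (n ∸ j)) (≡.sym (ℕₚ.m+[n∸m]≡n i≤k))))))) ⟩
      sumTo n (λ k → sumTo k (λ i → H i (k ∸ i)))
    ≈⟨ triangle n H ⟩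
      sumTo n (λ i → sumTo (n ∸ i) (H i))
    ≈⟨ sum-cong n (λ i _ → trans (sum-cong (n ∸ i) (λ j _ → trans (*-assoc _ _ _)
          (*-cong refl (*-cong refl (≡⇒≈ (≡.cong d (≡.sym (ℕₚ.∸-+-assoc n i j))))))))
          (sym (sum-*ˡ (n ∸ i) _ _))) ⟩
      sumTo n (λ i → a i * sumTo (n ∸ i) (λ j → b j * d (n ∸ i ∸ j)))
    ∎
    where
    H : ℕ → ℕ → Carrier
    H i j = a i * b j * d (n ∸ (i ℕ.+ j))

  inverseˡ : ∀ x → ¬ (x ≈ 0#) → inv x * x ≈ 1#
  inverseˡ x x≉0 = trans (*-comm _ _) (inverseʳ x x≉0)

  *-cancelˡ : ∀ {x y z} → ¬ (x ≈ 0#) → x * y ≈ x * z → y ≈ z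
  *-cancelˡ {x} {y} {z} x≉0 xy≈xz = begin
      y               ≈⟨ sym (*-identityˡ y) ⟩
      1# * y          ≈⟨ *-cong (sym (inverseˡ x x≉0)) refl ⟩
      (inv x * x) * y ≈⟨ *-assoc _ _ _ ⟩
      inv x * (x * y) ≈⟨ *-cong refl xy≈xz ⟩
      inv x * (x * z) ≈⟨ sym (*-assoc _ _ _) ⟩
      (inv x * x) * z ≈⟨ *-cong (inverseˡ x x≉0) refl ⟩
      1# * z          ≈⟨ *-identityˡ z ⟩
      z               ∎

  *-≉0 : ∀ {x y} → ¬ (x ≈ 0#) → ¬ (y ≈ 0#) → ¬ (x * y ≈ 0#)
  *-≉0 {x} x≉0 y≉0 xy≈0 = y≉0 (*-cancelˡ x≉0 (trans xy≈0 (sym (zeroʳ x))))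

  inv-unique : ∀ x y → ¬ (x ≈ 0#) → x * y ≈ 1# → y ≈ inv x
  inv-unique x y x≉0 xy≈1 = *-cancelˡ x≉0 (trans xy≈1 (sym (inverseʳ x x≉0)))

  inv-* : ∀ x y → ¬ (x ≈ 0#) → ¬ (y ≈ 0#) → inv (x * y) ≈ inv x * inv y
  inv-* x y x≉0 y≉0 = sym (inv-unique (x * y) (inv x * inv y) (*-≉0 x≉0 y≉0) (begin
      (x * y) * (inv x * inv y)
    ≈⟨ solve 4 (λ x y u v → ((x :* y) :* (u :* v)) := ((x :* u) :* (y :* v))) refl x y _ _ ⟩
      (x * inv x) * (y * inv y)
    ≈⟨ *-cong (inverseʳ x x≉0) (inverseʳ y y≉0) ⟩
      1# * 1#
    ≈⟨ *-identityˡ 1# ⟩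
      1# ∎))

  ι-+ : ∀ a b → ι (a ℕ.+ b) ≈ ι a + ι b
  ι-+ zero    b = sym (+-identityˡ _)
  ι-+ (suc a) b = trans (+-cong refl (ι-+ a b)) (sym (+-assoc _ _ _))

  ι-* : ∀ a b → ι (a ℕ.* b) ≈ ι a * ι b
  ι-* zero    b = sym (zeroˡ _)
  ι-* (suc a) b =
    trans (ι-+ b (a ℕ.* b)) (trans (+-cong (sym (*-identityˡ _)) (ι-* a b)) (sym (distribʳ _ _ _)))

  fact≉0 : ∀ n → ¬ (fact n ≈ 0#)
  fact≉0 n = ≡.subst (λ k → ¬ (ι k ≈ 0#)) (ℕₚ.suc-pred (n ℕ.!) {{n ℕₚ.!≢0}})
                     (char0 (ℕ.pred (n ℕ.!)))

  inv-fact0 : inv (fact 0) ≈ 1#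
  inv-fact0 = sym (inv-unique (fact 0) 1# (fact≉0 0) (trans (*-identityʳ _) (+-identityʳ 1#)))

  -- (n+1) / (n+1)! = 1 / n!, the identity behind differentiating t^{n+1}/(n+1)!
  ι-suc-inv-fact : ∀ n → ι (suc n) * inv (fact (suc n)) ≈ inv (fact n)
  ι-suc-inv-fact n = begin
      ι (suc n) * inv (fact (suc n))
    ≈⟨ *-cong refl (inv-cong (ι-* (suc n) (n ℕ.!))) ⟩
      ι (suc n) * inv (ι (suc n) * fact n)
    ≈⟨ *-cong refl (inv-* _ _ (char0 n) (fact≉0 n)) ⟩
      ι (suc n) * (inv (ι (suc n)) * inv (fact n))
    ≈⟨ sym (*-assoc _ _ _) ⟩
      (ι (suc n) * inv (ι (suc n))) * inv (fact n)
    ≈⟨ *-cong (inverseʳ _ (char0 n)) refl ⟩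
      1# * inv (fact n)
    ≈⟨ *-identityˡ _ ⟩
      inv (fact n) ∎

  -- Inverse series.  invS computes b₀ = a₀⁻¹, b_{n+1} = -a₀⁻¹ Σ_{i≤n} a_{i+1} b_{n-i}
  -- via a list [b_n, …, b₀] that Defs keeps private; matching the unfolded
  -- definition against a metavariable recovers that list as a function.

  private
    invS-unfolded : ∀ a n → Σ (ℕ → Carrier) λ earlier →
      invS a (suc n) ≡ - (inv (a 0) * sumTo n (λ i → a (suc i) * earlier i))
    invS-unfolded a n = _ , ≡.refl

  earlier : PS → ℕ → ℕ → Carrier
  earlier a n = proj₁ (invS-unfolded a n)

  earlier≡invS : ∀ a n i → i ≤ n → earlier a n i ≡ invS a (n ∸ i)
  earlier≡invS a n       zero    _         = ≡.refl
  earlier≡invS a (suc n) (suc i) (s≤s i≤n) = earlier≡invS a n i i≤n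

  invS-suc : ∀ a n → invS a (suc n) ≈ - (inv (a 0) * sumTo n (λ i → a (suc i) * invS a (n ∸ i)))
  invS-suc a n = -‿cong (*-cong refl (sum-cong n (λ i i≤n →
    *-cong refl (≡⇒≈ (earlier≡invS a n i i≤n)))))

  ⊗-suc : ∀ a b n → (a ⊗ b) (suc n) ≈ a 0 * b (suc n) + sumTo n (λ k → a (suc k) * b (n ∸ k))
  ⊗-suc a b n = sum-shift n _

  invS-inverse : ∀ a → ¬ (a 0 ≈ 0#) → (a ⊗ invS a) ≋ oneS
  invS-inverse a a₀≉0 zero    = inverseʳ (a 0) a₀≉0
  invS-inverse a a₀≉0 (suc n) = begin
      (a ⊗ invS a) (suc n)
    ≈⟨ ⊗-suc a (invS a) n ⟩
      a 0 * invS a (suc n) + S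
    ≈⟨ +-cong (*-cong refl (invS-suc a n)) refl ⟩
      a 0 * - (inv (a 0) * S) + S
    ≈⟨ +-cong (sym (-‿distribʳ-* _ _)) refl ⟩
      - (a 0 * (inv (a 0) * S)) + S
    ≈⟨ +-cong (-‿cong (trans (sym (*-assoc _ _ _)) (*-cong (inverseʳ _ a₀≉0) refl))) refl ⟩
      - (1# * S) + S
    ≈⟨ +-cong (-‿cong (*-identityˡ S)) refl ⟩
      - S + S
    ≈⟨ -‿inverseˡ S ⟩
      0# ∎
    where
    S = sumTo n (λ k → a (suc k) * invS a (n ∸ k))

  inverse-unique : ∀ a b d → ¬ (a 0 ≈ 0#) → (a ⊗ b) ≋ oneS → (a ⊗ d) ≋ oneS → b ≋ d
  inverse-unique a b d a₀≉0 ab≋1 ad≋1 n = upTo n n ℕₚ.≤-refl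
    where
    upTo : ∀ n k → k ≤ n → b k ≈ d k
    upTo zero    zero    z≤n = *-cancelˡ a₀≉0 (trans (ab≋1 0) (sym (ad≋1 0)))
    upTo (suc n) k k≤ with ℕₚ.m≤n⇒m<n∨m≡n k≤
    ... | inj₁ (s≤s k≤n) = upTo n k k≤n
    ... | inj₂ ≡.refl    = *-cancelˡ a₀≉0 (∙-cancelʳ _ _ _ (begin
        a 0 * b (suc n) + sumTo n (λ j → a (suc j) * b (n ∸ j))
      ≈⟨ sym (⊗-suc a b n) ⟩
        (a ⊗ b) (suc n)
      ≈⟨ trans (ab≋1 (suc n)) (sym (ad≋1 (suc n))) ⟩
        (a ⊗ d) (suc n)
      ≈⟨ ⊗-suc a d n ⟩
        a 0 * d (suc n) + sumTo n (λ j → a (suc j) * d (n ∸ j))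
      ≈⟨ +-cong refl (sum-cong n (λ j _ → *-cong refl (sym (upTo n (n ∸ j) (ℕₚ.m∸n≤m n j))))) ⟩
        a 0 * d (suc n) + sumTo n (λ j → a (suc j) * b (n ∸ j)) ∎))

  invS-unique : ∀ a b → ¬ (a 0 ≈ 0#) → (a ⊗ b) ≋ oneS → b ≋ invS a
  invS-unique a b a₀≉0 ab≋1 = inverse-unique a b (invS a) a₀≉0 ab≋1 (invS-inverse a a₀≉0)

  invS-cong : ∀ {a a′} → ¬ (a 0 ≈ 0#) → a ≋ a′ → invS a ≋ invS a′
  invS-cong {a} {a′} a₀≉0 a≋a′ = invS-unique a′ (invS a) (λ a′₀≈0 → a₀≉0 (trans (a≋a′ 0) a′₀≈0))
    (≋-trans (⊗-cong (≋-sym a≋a′) (≋-refl {invS a})) (invS-inverse a a₀≉0))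

  D : PS → PS
  D a n = ι (suc n) * a (suc n)

  -- Euler operator t·d/dt, i.e. a_n ↦ n a_n
  θ : PS → PS
  θ a n = ι n * a n

  leibniz : ∀ a b n → D (a ⊗ b) n ≈ (D a ⊗ b) n + (a ⊗ D b) n
  leibniz a b n = begin
      ι (suc n) * sumTo (suc n) (λ k → a k * b (suc n ∸ k))
    ≈⟨ sum-*ˡ (suc n) _ _ ⟩
      sumTo (suc n) (λ k → ι (suc n) * (a k * b (suc n ∸ k)))
    ≈⟨ sum-cong (suc n) (λ k k≤ → split (trans (≡⇒≈ (≡.cong ι (≡.sym (ℕₚ.m+[n∸m]≡n k≤))))
                                               (ι-+ k (suc n ∸ k)))) ⟩
      sumTo (suc n) (λ k → θ a k * b (suc n ∸ k) + a k * θ b (suc n ∸ k))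
    ≈⟨ sum-+ (suc n) _ _ ⟩
      sumTo (suc n) (λ k → θ a k * b (suc n ∸ k)) + sumTo (suc n) (λ k → a k * θ b (suc n ∸ k))
    ≈⟨ +-cong (trans (sum-shift n _) (trans (+-cong (trans (*-cong (zeroˡ _) refl) (zeroˡ _)) refl)
                                            (+-identityˡ _)))
              (trans (+-cong (sum-cong n (λ k k≤n → ≡⇒≈ (≡.cong (λ j → a k * θ b j) (suc∸ k≤n))))
                             (trans (*-cong refl (trans (*-cong (≡⇒≈ (≡.cong ι (ℕₚ.n∸n≡0 n))) refl)
                                                        (zeroˡ _)))
                                    (zeroʳ _)))
                     (+-identityʳ _)) ⟩
      (D a ⊗ b) n + (a ⊗ D b) n ∎
    where
    split : ∀ {o o₁ o₂ x y} → o ≈ o₁ + o₂ → o * (x * y) ≈ o₁ * x * y + x * (o₂ * y)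
    split {o₁ = o₁} {o₂} {x} {y} o≈ = trans (*-cong o≈ refl)
      (solve 4 (λ o₁ o₂ x y → ((o₁ :+ o₂) :* (x :* y)) := (o₁ :* x :* y :+ x :* (o₂ :* y))) refl o₁ o₂ x y)

  _^-cong_ : ∀ {x y} n → x ≈ y → x ^ n ≈ y ^ n
  zero  ^-cong x≈y = refl
  suc n ^-cong x≈y = *-cong x≈y (n ^-cong x≈y)

  exp-cong : ∀ {x y} → x ≈ y → expS x ≋ expS y
  exp-cong x≈y n = *-cong (n ^-cong x≈y) refl

  exp-0 : ∀ s → expS s 0 ≈ 1#
  exp-0 s = trans (*-identityˡ _) inv-fact0

  D-exp : ∀ s n → D (expS s) n ≈ s * expS s n
  D-exp s n = trans (solve 4 (λ o s p i → (o :* (s :* p :* i)) := (s :* (p :* (o :* i)))) refl _ _ _ _)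
                    (*-cong refl (*-cong refl (ι-suc-inv-fact n)))

  exp-unique : ∀ s f → f 0 ≈ 1# → D f ≋ scale s f → f ≋ expS s
  exp-unique s f f₀≈1 f′≈sf zero    = trans f₀≈1 (sym (exp-0 s))
  exp-unique s f f₀≈1 f′≈sf (suc n) = *-cancelˡ (char0 n)
    (trans (f′≈sf n) (trans (*-cong refl (exp-unique s f f₀≈1 f′≈sf n)) (sym (D-exp s n))))

  binom-0 : ∀ x → binomS x 0 ≈ 1#
  binom-0 x = trans (*-identityˡ _) inv-fact0

  -- the binomial series solves (1+t) f' = x f, coefficientwise
  binom-ode : ∀ x → (D (binomS x) ⊕ θ (binomS x)) ≋ scale x (binomS x)
  binom-ode x n = begin
      ι (suc n) * (fallingFact x n * (x - ι n) * inv (fact (suc n))) + ι n * β n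
    ≈⟨ +-cong (solve 4 (λ o f y i → (o :* (f :* y :* i)) := (y :* (f :* (o :* i)))) refl _ _ _ _) refl ⟩
      (x - ι n) * (fallingFact x n * (ι (suc n) * inv (fact (suc n)))) + ι n * β n
    ≈⟨ +-cong (*-cong refl (*-cong refl (ι-suc-inv-fact n))) refl ⟩
      (x - ι n) * β n + ι n * β n
    ≈⟨ sym (distribʳ (β n) _ _) ⟩
      ((x - ι n) + ι n) * β n
    ≈⟨ *-cong (trans (+-assoc _ _ _) (trans (+-cong refl (-‿inverseˡ (ι n))) (+-identityʳ x))) refl ⟩
      x * β n ∎
    where
    β = binomS x

  g : PS
  g = expMinus1

  G : ℕ → PS
  G = powS g

  g-0 : g 0 ≈ 0#
  g-0 = trans (+-cong (exp-0 1#) refl) (-‿inverseʳ 1#)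

  D-g : D g ≋ (oneS ⊕ g)
  D-g n = begin
      ι (suc n) * (expS 1# (suc n) + - 0#)
    ≈⟨ *-cong refl (trans (+-cong refl -0#≈0#) (+-identityʳ _)) ⟩
      ι (suc n) * expS 1# (suc n)
    ≈⟨ trans (D-exp 1# n) (*-identityˡ _) ⟩
      expS 1# n
    ≈⟨ sym (trans (+-cong refl (+-comm _ _)) (trans (sym (+-assoc _ _ _))
         (trans (+-cong (-‿inverseʳ _) refl) (+-identityˡ _)))) ⟩
      (oneS ⊕ g) n ∎

  G-vanish : ∀ i k → k < i → G i k ≈ 0#
  G-vanish (suc i) zero    _         = trans (*-cong g-0 refl) (zeroˡ _)
  G-vanish (suc i) (suc k) (s≤s k<i) = trans (sum-shift k _)
    (trans (+-cong (trans (*-cong g-0 refl) (zeroˡ _))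
                   (sum-zero k _ (λ l _ → trans (*-cong refl
                      (G-vanish i (k ∸ l) (ℕₚ.≤-<-trans (ℕₚ.m∸n≤m k l) k<i))) (zeroʳ _))))
           (+-identityˡ 0#))

  G-+ : ∀ i j → G (i ℕ.+ j) ≋ (G i ⊗ G j)
  G-+ zero    j = ≋-sym (⊗-identityˡ (G j))
  G-+ (suc i) j = ≋-trans (⊗-cong (≋-refl {g}) (G-+ i j)) (≋-sym (⊗-assoc g (G i) (G j)))

  -- power rule: (g^{n+1})' = (n+1) gⁿ g' = (n+1)(gⁿ + g^{n+1})
  D-G : ∀ n m → D (G (suc n)) m ≈ ι (suc n) * (G n m + G (suc n) m)
  D-G n m = begin
      D (g ⊗ G n) m
    ≈⟨ leibniz g (G n) m ⟩
      (D g ⊗ G n) m + (g ⊗ D (G n)) m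
    ≈⟨ +-cong (trans (⊗-cong D-g (≋-refl {G n}) m) (trans (⊗-distribʳ oneS g (G n) m)
                                                          (+-cong (⊗-identityˡ (G n) m) refl)))
              (lower n) ⟩
      (G n m + G (suc n) m) + ι n * (G n m + G (suc n) m)
    ≈⟨ solve 2 (λ u o → (u :+ o :* u) := ((con 1 :+ o) :* u)) refl _ _ ⟩
      ι (suc n) * (G n m + G (suc n) m) ∎
    where
    lower : ∀ n → (g ⊗ D (G n)) m ≈ ι n * (G n m + G (suc n) m)
    lower zero    = trans (sum-zero m _ (λ k _ → trans (*-cong refl (zeroʳ _)) (zeroʳ _)))
                          (sym (zeroˡ _))
    lower (suc n) = begin
        (g ⊗ D (G (suc n))) m
      ≈⟨ ⊗-cong (≋-refl {g}) (D-G n) m ⟩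
        (g ⊗ scale (ι (suc n)) (G n ⊕ G (suc n))) m
      ≈⟨ ⊗-scaleʳ g (ι (suc n)) (G n ⊕ G (suc n)) m ⟩
        ι (suc n) * (g ⊗ (G n ⊕ G (suc n))) m
      ≈⟨ *-cong refl (⊗-distribˡ g (G n) (G (suc n)) m) ⟩
        ι (suc n) * (G (suc n) m + G (suc (suc n)) m) ∎

  record IsSeriesHom (Φ : PS → PS) : Set (c ⊔ ℓ) where
    field
      cong      : ∀ {a b} → a ≋ b → Φ a ≋ Φ b
      ⊗-hom     : ∀ a b → Φ (a ⊗ b) ≋ (Φ a ⊗ Φ b)
      ⊕-hom     : ∀ a b → Φ (a ⊕ b) ≋ (Φ a ⊕ Φ b)
      scale-hom : ∀ s a → Φ (scale s a) ≋ scale s (Φ a)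
      oneS-hom  : Φ oneS ≋ oneS
      const-hom : ∀ a → Φ a 0 ≈ a 0

  hom-ratio : ∀ {Φ} → IsSeriesHom Φ → ∀ {a a′ b b′} → ¬ (a′ 0 ≈ 0#) →
              Φ a ≋ a′ → Φ b ≋ b′ → Φ (invS a ⊗ b) ≋ (invS a′ ⊗ b′)
  hom-ratio {Φ} hom {a} {a′} a′₀≉0 Φa≋a′ Φb≋b′ =
    ≋-trans (⊗-hom (invS a) _) (⊗-cong (≋-trans Φ-invS (invS-cong Φa₀≉0 Φa≋a′)) Φb≋b′)
    where
    open IsSeriesHom hom
    a₀≉0 : ¬ (a 0 ≈ 0#)
    a₀≉0 a₀≈0 = a′₀≉0 (trans (sym (Φa≋a′ 0)) (trans (const-hom a) a₀≈0))
    Φa₀≉0 : ¬ (Φ a 0 ≈ 0#)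
    Φa₀≉0 Φa₀≈0 = a₀≉0 (trans (sym (const-hom a)) Φa₀≈0)
    Φ-invS : Φ (invS a) ≋ invS (Φ a)
    Φ-invS = invS-unique (Φ a) (Φ (invS a)) Φa₀≉0
      (≋-trans (≋-sym (⊗-hom a (invS a))) (≋-trans (cong (invS-inverse a a₀≉0)) oneS-hom))

  -- composition with g:  a(t) ↦ a(e^t - 1) = Σ_n a_n gⁿ
  comp : PS → PS
  comp a m = sumTo m (λ n → a n * G n m)

  comp-shift : ∀ a m → sumTo m (λ n → θ a (suc n) * G (suc n) m) ≈ comp (θ a) m
  comp-shift a m = begin
      sumTo m (λ n → f (suc n))
    ≈⟨ sym (+-identityˡ _) ⟩
      0# + sumTo m (λ n → f (suc n))
    ≈⟨ +-cong (sym (trans (*-cong (zeroˡ _) refl) (zeroˡ _))) refl ⟩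
      f 0 + sumTo m (λ n → f (suc n))
    ≈⟨ sym (sum-shift m f) ⟩
      sumTo m f + f (suc m)
    ≈⟨ +-cong refl (trans (*-cong refl (G-vanish (suc m) m ℕₚ.≤-refl)) (zeroʳ _)) ⟩
      sumTo m f + 0#
    ≈⟨ +-identityʳ _ ⟩
      sumTo m f ∎
    where
    f : ℕ → Carrier
    f n = θ a n * G n m

  -- chain rule with g' = 1 + g:  (a ∘ g)' = ((1+t) a') ∘ g
  D-comp : ∀ a → D (comp a) ≋ comp (D a ⊕ θ a)
  D-comp a m = begin
      ι (suc m) * sumTo (suc m) (λ n → a n * G n (suc m))
    ≈⟨ trans (sum-*ˡ (suc m) _ _) (sum-cong (suc m) (λ n _ → x∙yz≈y∙xz _ _ _)) ⟩
      sumTo (suc m) (λ n → a n * D (G n) m)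
    ≈⟨ sum-shift m _ ⟩
      a 0 * (ι (suc m) * 0#) + sumTo m (λ n → a (suc n) * D (G (suc n)) m)
    ≈⟨ +-cong (trans (*-cong refl (zeroʳ _)) (zeroʳ _)) (sum-cong m (λ n _ →
         trans (*-cong refl (D-G n m))
               (solve 4 (λ b o u v → (b :* (o :* (u :+ v))) := (o :* b :* u :+ o :* b :* v))
                      refl _ _ _ _))) ⟩
      0# + sumTo m (λ n → D a n * G n m + θ a (suc n) * G (suc n) m)
    ≈⟨ trans (+-identityˡ _) (sum-+ m _ _) ⟩
      comp (D a) m + sumTo m (λ n → θ a (suc n) * G (suc n) m)
    ≈⟨ +-cong refl (comp-shift a m) ⟩
      comp (D a) m + comp (θ a) m
    ≈⟨ sym (trans (sum-cong m (λ n _ → distribʳ _ _ _)) (sum-+ m _ _)) ⟩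
      comp (D a ⊕ θ a) m ∎

  comp-⊗ : ∀ a b → comp (a ⊗ b) ≋ (comp a ⊗ comp b)
  comp-⊗ a b m = begin
      sumTo m (λ n → sumTo n (λ i → a i * b (n ∸ i)) * G n m)
    ≈⟨ sum-cong m (λ n n≤m → trans (sum-*ʳ n _ _) (sum-cong n (λ i i≤n →
          *-cong refl (trans (≡⇒≈ (≡.cong (λ k → G k m) (≡.sym (ℕₚ.m+[n∸m]≡n i≤n))))
                             (G-+ i (n ∸ i) m))))) ⟩
      sumTo m (λ n → sumTo n (λ i → H i (n ∸ i)))
    ≈⟨ triangle m H ⟩
      sumTo m (λ i → sumTo (m ∸ i) (H i))
    ≈⟨ sum-cong m (λ i _ → sym (sum-extend (m ∸ i) m (H i) (ℕₚ.m∸n≤m m i)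
          (λ j m∸i<j _ → trans (*-cong refl (GG-vanish i j m∸i<j)) (zeroʳ _)))) ⟩
      sumTo m (λ i → sumTo m (H i))
    ≈⟨ sum-cong m (λ i _ → sum-cong m (λ j _ →
          trans (sum-*ˡ m _ _) (sum-cong m (λ k _ → rearrange _ _ _ _)))) ⟩
      sumTo m (λ i → sumTo m (λ j → sumTo m (T i j)))
    ≈⟨ trans (sum-cong m (λ i _ → sum-swap m m _)) (sum-swap m m _) ⟩
      sumTo m (λ k → sumTo m (λ i → sumTo m (λ j → T i j k)))
    ≈⟨ sym (sum-cong m (λ k _ → trans (sum-*ʳ m _ _) (sum-cong m (λ i _ → sum-*ˡ m _ _)))) ⟩
      sumTo m (λ k → sumTo m (λ i → a i * G i k) * sumTo m (λ j → b j * G j (m ∸ k)))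
    ≈⟨ sum-cong m (λ k k≤m → *-cong
          (sum-extend k m _ k≤m (λ i k<i _ → trans (*-cong refl (G-vanish i k k<i)) (zeroʳ _)))
          (sum-extend (m ∸ k) m _ (ℕₚ.m∸n≤m m k)
             (λ j lt _ → trans (*-cong refl (G-vanish j (m ∸ k) lt)) (zeroʳ _)))) ⟩
      (comp a ⊗ comp b) m ∎
    where
    H : ℕ → ℕ → Carrier
    H i j = a i * b j * (G i ⊗ G j) m
    T : ℕ → ℕ → ℕ → Carrier
    T i j k = a i * G i k * (b j * G j (m ∸ k))
    GG-vanish : ∀ i j → m ∸ i < j → (G i ⊗ G j) m ≈ 0#
    GG-vanish i j m∸i<j = trans (sym (G-+ i j m)) (G-vanish (i ℕ.+ j) m
      (ℕₚ.≤-<-trans (ℕₚ.m≤n+m∸n m i) (ℕₚ.+-monoʳ-< i m∸i<j)))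
    rearrange : ∀ a b u v → a * b * (u * v) ≈ a * u * (b * v)
    rearrange = solve 4 (λ a b u v → (a :* b :* (u :* v)) := (a :* u :* (b :* v))) refl

  comp-hom : IsSeriesHom comp
  comp-hom = record
    { cong      = λ a≋b m → sum-cong m (λ n _ → *-cong (a≋b n) refl)
    ; ⊗-hom     = comp-⊗
    ; ⊕-hom     = λ a b m → trans (sum-cong m (λ n _ → distribʳ _ _ _)) (sum-+ m _ _)
    ; scale-hom = λ s a m → trans (sum-cong m (λ n _ → *-assoc _ _ _)) (sym (sum-*ˡ m s _))
    ; oneS-hom  = comp-oneS
    ; const-hom = λ a → *-identityʳ _
    }
    where
    comp-oneS : comp oneS ≋ oneS
    comp-oneS zero    = *-identityˡ 1#
    comp-oneS (suc m) = trans (sum-shift m _)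
      (trans (+-cong (*-identityˡ _) (sum-zero m _ (λ _ _ → zeroˡ _))) (+-identityˡ 0#))

  comp-binom : ∀ x → comp (binomS x) ≋ expS x
  comp-binom x = exp-unique x (comp (binomS x)) (trans (*-identityʳ _) (binom-0 x))
    (≋-trans (D-comp (binomS x))
      (≋-trans (IsSeriesHom.cong comp-hom (binom-ode x)) (IsSeriesHom.scale-hom comp-hom x _)))

  -- rescaling t ↦ l t
  sc : Carrier → PS → PS
  sc l a m = a m * l ^ m

  ^-+ : ∀ x i j → x ^ (i ℕ.+ j) ≈ x ^ i * x ^ j
  ^-+ x zero    j = sym (*-identityˡ _)
  ^-+ x (suc i) j = trans (*-cong refl (^-+ x i j)) (sym (*-assoc _ _ _))

  ^-* : ∀ x y n → (x * y) ^ n ≈ x ^ n * y ^ n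
  ^-* x y zero    = sym (*-identityˡ 1#)
  ^-* x y (suc n) = trans (*-cong refl (^-* x y n))
    (solve 4 (λ x y a b → (x :* y :* (a :* b)) := (x :* a :* (y :* b))) refl x y _ _)

  sc-hom : ∀ l → IsSeriesHom (sc l)
  sc-hom l = record
    { cong      = λ a≋b m → *-cong (a≋b m) refl
    ; ⊗-hom     = sc-⊗
    ; ⊕-hom     = λ a b m → distribʳ _ _ _
    ; scale-hom = λ s a m → *-assoc _ _ _
    ; oneS-hom  = λ { zero → *-identityˡ _ ; (suc m) → zeroˡ _ }
    ; const-hom = λ a → *-identityʳ _
    }
    where
    sc-⊗ : ∀ a b → sc l (a ⊗ b) ≋ (sc l a ⊗ sc l b)
    sc-⊗ a b m = trans (sum-*ʳ m _ _) (sum-cong m (λ k k≤m →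
      trans (*-cong refl (trans (≡⇒≈ (≡.cong (l ^_) (≡.sym (ℕₚ.m+[n∸m]≡n k≤m)))) (^-+ l k (m ∸ k))))
            (solve 4 (λ a u b v → (a :* u :* (b :* v)) := (a :* b :* (u :* v))) refl _ _ _ _)))

  sc-exp : ∀ l s → sc l (expS s) ≋ expS (s * l)
  sc-exp l s m = trans (solve 3 (λ u i v → (u :* i :* v) := (u :* v :* i)) refl _ _ _)
                       (*-cong (sym (^-* s l m)) refl)

  -- the common denominator 1 + q e^{λt}; its constant term is [2]_q
  denominator≉0 : ∀ q lam → ¬ ([2] q ≈ 0#) → ¬ ((oneS ⊕ scale q (expS lam)) 0 ≈ 0#)
  denominator≉0 q lam [2]q≉0 d₀≈0 =
    [2]q≉0 (trans (+-cong refl (sym (trans (*-cong refl (exp-0 lam)) (*-identityʳ q)))) d₀≈0)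

  boole-comp : ∀ q lam x → ¬ ([2] q ≈ 0#) →
    comp (invS (oneS ⊕ scale q (binomS lam)) ⊗ binomS x)
      ≋ (invS (oneS ⊕ scale q (expS lam)) ⊗ expS x)
  boole-comp q lam x [2]q≉0 = hom-ratio comp-hom (denominator≉0 q lam [2]q≉0)
    (≋-trans (⊕-hom _ _) (⊕-cong oneS-hom (≋-trans (scale-hom q _) (scale-cong refl (comp-binom lam)))))
    (comp-binom x)
    where open IsSeriesHom comp-hom

  euler-sc : ∀ q lam x → ¬ ([2] q ≈ 0#) → ¬ (lam ≈ 0#) →
    sc lam (invS (scale q (expS 1#) ⊕ oneS) ⊗ expS (x * inv lam))
      ≋ (invS (oneS ⊕ scale q (expS lam)) ⊗ expS x)
  euler-sc q lam x [2]q≉0 lam≉0 = hom-ratio (sc-hom lam) (denominator≉0 q lam [2]q≉0)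
    (≋-trans (⊕-hom _ _) (≋-trans (⊕-cong (≋-trans (scale-hom q _)
       (scale-cong refl (≋-trans (sc-exp lam 1#) (exp-cong (*-identityˡ lam))))) oneS-hom)
       (⊕-comm _ _)))
    (≋-trans (sc-exp lam _) (exp-cong x/λ·λ≈x))
    where
    open IsSeriesHom (sc-hom lam)
    x/λ·λ≈x : x * inv lam * lam ≈ x
    x/λ·λ≈x = trans (*-assoc _ _ _) (trans (*-cong refl (inverseˡ lam lam≉0)) (*-identityʳ x))

  -- Σ_{n≤m} n! bₙ S₂(m,n) = m! [t^m] (b ∘ g), from S₂(m,n) = (m!/n!) [t^m] gⁿ
  stirling-comp : ∀ b m → sumTo m (λ n → fact n * b n * S₂ m n) ≈ fact m * comp b m
  stirling-comp b m = trans (sum-cong m (λ n _ → trans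
      (solve 5 (λ f b f′ i u → (f :* b :* (f′ :* i :* u)) := (f′ :* (b :* u) :* (f :* i))) refl _ _ _ _ _)
      (trans (*-cong refl (inverseʳ _ (fact≉0 n))) (*-identityʳ _))))
    (sym (sum-*ˡ m _ _))

  -- Theorem 2.2 over the field F: both sides are m! times [t^m] of e^{xt}/(1 + q e^{λt})
  theorem : (q lam x : Carrier) → ¬ ([2] q ≈ 0#) → ¬ (lam ≈ 0#) → (m : ℕ) →
    sumTo m (λ n → Bl n q x lam * S₂ m n)
      ≈ inv ([2] q) * E m q (x * inv lam) * (lam ^ m)
  theorem q lam x [2]q≉0 lam≉0 m = begin
      sumTo m (λ n → fact n * B n * S₂ m n)
    ≈⟨ stirling-comp B m ⟩
      fact m * comp B m
    ≈⟨ *-cong refl (boole-comp q lam x [2]q≉0 m) ⟩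
      fact m * (invS (oneS ⊕ scale q (expS lam)) ⊗ expS x) m
    ≈⟨ *-cong refl (sym (euler-sc q lam x [2]q≉0 lam≉0 m)) ⟩
      fact m * (e m * lam ^ m)
    ≈⟨ sym (cancel-[2] (fact m) (e m) (lam ^ m)) ⟩
      inv ([2] q) * E m q (x * inv lam) * lam ^ m ∎
    where
    B : PS
    B = invS (oneS ⊕ scale q (binomS lam)) ⊗ binomS x
    e : PS
    e = invS (scale q (expS 1#) ⊕ oneS) ⊗ expS (x * inv lam)
    -- E_{m,q} carries the factor [2]_q, which the prefactor [2]_q⁻¹ cancels
    cancel-[2] : ∀ f u l → inv ([2] q) * (f * ([2] q * u)) * l ≈ f * (u * l)
    cancel-[2] f u l = begin
        inv ([2] q) * (f * ([2] q * u)) * l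
      ≈⟨ solve 5 (λ i f t u l → (i :* (f :* (t :* u)) :* l) := (f :* (u :* l) :* (i :* t)))
               refl _ f _ u l ⟩
        f * (u * l) * (inv ([2] q) * [2] q)
      ≈⟨ *-cong refl (inverseˡ _ [2]q≉0) ⟩
        f * (u * l) * 1#
      ≈⟨ *-identityʳ _ ⟩
        f * (u * l) ∎

theorem2p2 : ∀ {c ℓ} (F : Char0Field c ℓ) →
    let open Series F in
    (q lam x : Carrier) → ¬ ([2] q ≈ 0#) → ¬ (lam ≈ 0#) → (m : ℕ) →
    sumTo m (λ n → Bl n q x lam * S₂ m n)
    ≈ inv ([2] q) * E m q (x * inv lam) * (lam ^ m)
theorem2p2 F = Proof.theorem F
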